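{- Let $(X,\vartheta)$ be an ordinary system with states $x,y\in X$. If $x\leftrightarrow y$ (ordinary behavioural equivalence), then $x=_! y$ in the discrete $B_M$-coalgebra $(X,=,\vartheta)$.
   Context: An inequational theory $(S,\mathsf{IN})$ (not necessarily iterative) consists of, for each $n\in\mathbb N$, a poset $(I_n,\le_n)$ of $n$-ary operation symbols and a set $\mathsf{IN}$ of pairs of $S$-terms. For a poset $(X,\le)$, $\sqsubseteq_{\mathsf{IN}}$ is the least preorder on $S$-terms over $X$ with: $x\sqsubseteq_{\mathsf{IN}}y$ if $x\le y$; $\sigma(\vec p)\sqsubseteq_{\mathsf{IN}}\sigma(\vec q)$ if $p_i\sqsubseteq_{\mathsf{IN}}q_i$; $\sigma_1(\vec p)\sqsubseteq_{\mathsf{IN}}\sigma_2(\vec p)$ if $\sigma_1\le_n\sigma_2$; $p(\vec r)\sqsubseteq_{\mathsf{IN}}q(\vec r)$ for $(p,q)\in\mathsf{IN}$. $M(X,\le)$ is the poset of $\equiv_{\mathsf{IN}}$-classes ordered by $\sqsubseteq_{\mathsf{IN}}$; $M$ is a functor on posets (renaming variables); $x\sqsubseteq_{\mathsf{IN}}y$ implies $x\le y$ for variables. $\mathsf{Var}$ is an infinite set of return variables and $\mathsf{Act}$ a set of actions, both discretely ordered. $B_M(X,\le)=M((\mathsf{Var},=)+(\mathsf{Act},=)\times(X,\le))$. Let $U:\mathbf{Pos}\to\mathbf{Sets}$ be the forgetful functor and $D:\mathbf{Sets}\to\mathbf{Pos}$ the discrete-order functor; $N=UMD$ and $B_N=N(\mathsf{Var}+\mathsf{Act}\times(-))$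 on $\mathbf{Sets}$. An ordinary system is $(X,\vartheta)$ with $\vartheta:X\to B_NX$; since $B_NX$ is the underlying set of $B_M(X,=)$, it is also a monotone $B_M$-coalgebra $(X,=,\vartheta)$. Ordinary behavioural equivalence: $x\leftrightarrow y$ iff there is a $B_N$-coalgebra homomorphism $h:(X,\vartheta)\to(Y,\delta)$ (a function with $\delta\circ h=B_N(h)\circ\vartheta$) with $h(x)=h(y)$. Ordered behavioural equivalence: $x=_!y$ iff there are a $B_M$-coalgebra $(Y,\le,\delta)$ and monotone coalgebra homomorphisms $h_1,h_2:(X,=,\vartheta)\to(Y,\le,\delta)$ (i.e. $\delta\circ h_i=B_M(h_i)\circ\vartheta$) with $h_1(x)=h_2(y)$. -}

module Defs where

open import Level using (0ℓ)
open import Data.Nat using (ℕ)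
open import Data.Fin using (Fin)
open import Data.Sum using (_⊎_; inj₁; inj₂)
open import Data.Product using (Σ; _×_; _,_)
open import Function using (_∘_)
open import Function.Definitions using (Injective)
open import Relation.Binary.PropositionalEquality using (_≡_)
open import Relation.Binary.Structures using (IsPartialOrder)

record Signature : Set₁ where
  field
    I         : ℕ → Set
    _≤I_      : ∀ {n} → I n → I n → Set
    ≤I-poset  : ∀ {n} → IsPartialOrder (_≡_ {A = I n}) (_≤I_ {n})

module Terms (S : Signature) where
  open Signature S

  data Term (X : Set) : Set where
    var : X → Term X
    op  : (n : ℕ) → I n → (Fin n → Term X) → Term X

  mapT : {X Y : Set} → (X → Y) → Term X → Term Y
  mapT f (var x)     = var (f x)
  mapT f (op n σ ps) = op n σ (λ i → mapT f (ps i))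

  substT : {V X : Set} → (V → Term X) → Term V → Term X
  substT r (var v)     = r v
  substT r (op n σ ps) = op n σ (λ i → substT r (ps i))

record InTheory : Set₁ where
  field
    sig : Signature
  open Signature sig public
  open Terms sig public
  field
    IN : Term ℕ → Term ℕ → Set

  data Sqsub {X : Set} (_≤_ : X → X → Set) : Term X → Term X → Set where
    ⊑-var   : ∀ {x y} → x ≤ y → Sqsub _≤_ (var x) (var y)
    ⊑-cong  : ∀ {n σ} {ps qs : Fin n → Term X} →
              (∀ i → Sqsub _≤_ (ps i) (qs i)) → Sqsub _≤_ (op n σ ps) (op n σ qs)
    ⊑-sym   : ∀ {n σ₁ σ₂} {ps : Fin n → Term X} →
              σ₁ ≤I σ₂ → Sqsub _≤_ (op n σ₁ ps) (op n σ₂ ps)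
    ⊑-ax    : ∀ {p q} (r : ℕ → Term X) →
              IN p q → Sqsub _≤_ (substT r p) (substT r q)
    ⊑-refl  : ∀ {p} → Sqsub _≤_ p p
    ⊑-trans : ∀ {p q s} → Sqsub _≤_ p q → Sqsub _≤_ q s → Sqsub _≤_ p s

  _⊑[_]_ : {X : Set} → Term X → (X → X → Set) → Term X → Set
  p ⊑[ _≤_ ] q = Sqsub _≤_ p q

  -- ≡_IN : the equality of M(X,≤) (elements of M(X,≤) are ≡_IN-classes)
  _≡[_]_ : {X : Set} → Term X → (X → X → Set) → Term X → Set
  p ≡[ _≤_ ] q = p ⊑[ _≤_ ] q × q ⊑[ _≤_ ] p

ReflectsVars : InTheory → Set₁
ReflectsVars T = ∀ {X : Set} {_≤_ : X → X → Set} → IsPartialOrder _≡_ _≤_ →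
  ∀ {x y : X} → var x ⊑[ _≤_ ] var y → x ≤ y
  where open InTheory T

module Behaviour (T : InTheory) (Var Act : Set) where
  open InTheory T

  data Lift {X : Set} (_≤_ : X → X → Set) : Var ⊎ (Act × X) → Var ⊎ (Act × X) → Set where
    lvar : ∀ {v} → Lift _≤_ (inj₁ v) (inj₁ v)
    lact : ∀ {a x y} → x ≤ y → Lift _≤_ (inj₂ (a , x)) (inj₂ (a , y))

  -- B X : representatives of elements of B_M(X,≤) (and of B_N X)
  B : Set → Set
  B X = Term (Var ⊎ (Act × X))

  Bmap : {X Y : Set} → (X → Y) → B X → B Y
  Bmap h = mapT (λ { (inj₁ v) → inj₁ v ; (inj₂ (a , x)) → inj₂ (a , h x) })

  System : Set₁
  System = Σ Set λ X → X → B X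

  -- B_N-coalgebra homomorphism h : (X,ϑ) → (Y,δ); equality in N = UMD
  -- is ≡_IN w.r.t. the discrete order
  IsNHom : {X Y : Set} → (X → B X) → (Y → B Y) → (X → Y) → Set
  IsNHom {X} {Y} ϑ δ h = ∀ (x : X) → δ (h x) ≡[ Lift _≡_ ] Bmap h (ϑ x)

  BehEq : {X : Set} → (X → B X) → X → X → Set₁
  BehEq {X} ϑ x y =
    Σ Set λ Y → Σ (Y → B Y) λ δ → Σ (X → Y) λ h →
      IsNHom ϑ δ h × h x ≡ h y

  record OrdCoalg : Set₁ where
    field
      Y     : Set
      _≤_   : Y → Y → Set
      poset : IsPartialOrder _≡_ _≤_
      δ     : Y → B Y
      mono  : ∀ {y y'} → y ≤ y' → δ y ⊑[ Lift _≤_ ] δ y'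

  -- monotone coalgebra homomorphism (X,=,ϑ) → (Y,≤,δ); monotonicity of h
  -- w.r.t. the discrete order on X is automatic.
  IsMHom : {X : Set} → (X → B X) → (C : OrdCoalg) → (X → OrdCoalg.Y C) → Set
  IsMHom {X} ϑ C h = ∀ (x : X) → δ (h x) ≡[ Lift _≤_ ] Bmap h (ϑ x)
    where open OrdCoalg C

  OrdBehEq : {X : Set} → (X → B X) → X → X → Set₁
  OrdBehEq {X} ϑ x y =
    Σ OrdCoalg λ C → Σ (X → OrdCoalg.Y C) λ h₁ → Σ (X → OrdCoalg.Y C) λ h₂ →
      IsMHom ϑ C h₁ × IsMHom ϑ C h₂ × h₁ x ≡ h₂ y

Infinite : Set → Set
Infinite A = Σ (ℕ → A) λ f → Injective _≡_ _≡_ f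

{-# OPTIONS --safe #-}
module Submission where

-- A B_N-homomorphism h : (X, ϑ) → (Y, δ) is already a monotone B_M-homomorphism
-- into the discretely ordered coalgebra (Y, =, δ), so h₁ = h₂ = h witnesses x =! y.

open import Defs
open import Data.Product using (_,_)
open import Function using (id)
open import Relation.Binary.PropositionalEquality using (_≡_; refl)
open import Relation.Binary.PropositionalEquality.Properties using (isPartialOrder)

module DiscreteCoalgebra (T : InTheory) (Var Act : Set) where
  open InTheory T
  open Behaviour T Var Act

  discrete : {Y : Set} → (Y → B Y) → OrdCoalg
  discrete {Y} δ = record
    { Y = Y ; _≤_ = _≡_ ; poset = isPartialOrder ; δ = δ ; mono = mono }
    where
    mono : ∀ {y y′ : Y} → y ≡ y′ → δ y ⊑[ Lift _≡_ ] δ y′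
    mono refl = ⊑-refl

  isNHom⇒isMHom-discrete : {X Y : Set} {ϑ : X → B X} (δ : Y → B Y) {h : X → Y} →
                           IsNHom ϑ δ h → IsMHom ϑ (discrete δ) h
  isNHom⇒isMHom-discrete _ = id

  behEq⇒ordBehEq : {X : Set} {ϑ : X → B X} {x y : X} → BehEq ϑ x y → OrdBehEq ϑ x y
  behEq⇒ordBehEq (_ , δ , h , hom , hx≡hy) =
    discrete δ , h , h , isNHom⇒isMHom-discrete δ hom , isNHom⇒isMHom-discrete δ hom , hx≡hy

lemma8p1 : (T : InTheory) → ReflectsVars T → (Var Act : Set) → Infinite Var →
    (X : Set) (ϑ : X → Behaviour.B T Var Act X) (x y : X) →
    Behaviour.BehEq T Var Act ϑ x y → Behaviour.OrdBehEq T Var Act ϑ x y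
lemma8p1 T _ Var Act _ _ _ _ _ = DiscreteCoalgebra.behEq⇒ordBehEq T Var Act
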